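{- For $n\ge 3$, the number of permutations $\pi\in S_n$ with $\operatorname{ipcni}_{n-2}(\pi)=2$ is $(n-2)!\,(n^2-3n+1)$. Hence \[\frac{K_{n,n-2}(x)}{(n-2)!}=(n^2-3n+1)x^2+2(n-1)x+1.\]
   Context: $S_n$ is the set of permutations of $\{1,\dots,n\}$. A $k$-step inversion of $\pi$ is a pair $(a,b)$ with $b-a=k$ and $\pi(a)>\pi(b)$. A certified non-inversion of $\pi$ is a triple of positions $a<c<b$ with $\pi(a)<\pi(b)<\pi(c)$ such that no position $d$ with $a<d<b$ has $\pi(d)>\pi(c)$; it is a certified $k$-step non-inversion if $b-a=k$. $\operatorname{ipcni}_k(\pi)$ is the number of $k$-step inversions plus the number of certified $k$-step non-inversions of $\pi$, and $K_{n,k}(x)=\sum_{\pi\in S_n}x^{\operatorname{ipcni}_k(\pi)}$. -}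

module Defs where

open import Data.Nat using (ℕ; zero; suc; _+_; _*_; _∸_; _<ᵇ_; _≡ᵇ_; _!)
open import Data.Bool using (Bool; true; false; _∧_; not)
open import Data.Fin using (Fin; toℕ)
open import Data.Vec using (Vec; []; _∷_; lookup)
open import Data.List using (List; []; _∷_; length; filterᵇ; concatMap; map; allFin)

allᵇ : {A : Set} → (A → Bool) → List A → Bool
allᵇ p [] = true
allᵇ p (x ∷ xs) = p x ∧ allᵇ p xs

sumL : List ℕ → ℕ
sumL [] = 0
sumL (x ∷ xs) = x + sumL xs

vecs : (n k : ℕ) → List (Vec (Fin n) k)
vecs n zero = [] ∷ []
vecs n (suc k) = concatMap (λ x → map (x ∷_) (vecs n k)) (allFin n)

-- A vector π of length n with entries in Fin n represents the map
-- position a ↦ π(a); positions are 0,…,n-1 (a shift of 1,…,n).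
val : {n : ℕ} → Vec (Fin n) n → Fin n → ℕ
val π a = toℕ (lookup π a)

injectiveᵇ : {n : ℕ} → Vec (Fin n) n → Bool
injectiveᵇ {n} π =
  allᵇ (λ a → allᵇ (λ b → not (toℕ a <ᵇ toℕ b) ∨′ not (val π a ≡ᵇ val π b)) (allFin n)) (allFin n)
  where
  _∨′_ : Bool → Bool → Bool
  true ∨′ _ = true
  false ∨′ y = y

S : (n : ℕ) → List (Vec (Fin n) n)
S n = filterᵇ injectiveᵇ (vecs n n)

count : {A : Set} → (A → Bool) → List A → ℕ
count p xs = length (filterᵇ p xs)

stepInv : {n : ℕ} → ℕ → Vec (Fin n) n → ℕ
stepInv {n} k π =
  sumL (map (λ a → count (λ b → (toℕ b ≡ᵇ toℕ a + k) ∧ (val π b <ᵇ val π a)) (allFin n)) (allFin n))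

certifiedᵇ : {n : ℕ} → ℕ → Vec (Fin n) n → Fin n → Fin n → Fin n → Bool
certifiedᵇ {n} k π a c b =
  (toℕ a <ᵇ toℕ c) ∧ (toℕ c <ᵇ toℕ b) ∧ (toℕ b ≡ᵇ toℕ a + k)
  ∧ (val π a <ᵇ val π b) ∧ (val π b <ᵇ val π c)
  ∧ allᵇ (λ d → not ((toℕ a <ᵇ toℕ d) ∧ (toℕ d <ᵇ toℕ b) ∧ (val π c <ᵇ val π d))) (allFin n)

stepCNI : {n : ℕ} → ℕ → Vec (Fin n) n → ℕ
stepCNI {n} k π =
  sumL (map (λ a → sumL (map (λ c → count (certifiedᵇ k π a c) (allFin n)) (allFin n))) (allFin n))

ipcni : {n : ℕ} → ℕ → Vec (Fin n) n → ℕ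
ipcni k π = stepInv k π + stepCNI k π

-- coefficient of x^j in K_{n,k}(x) = Σ_{π ∈ S_n} x^{ipcni_k(π)}
Kcoeff : (n k j : ℕ) → ℕ
Kcoeff n k j = count (λ π → ipcni k π ≡ᵇ j) (S n)

rhsCoeff : ℕ → ℕ → ℕ
rhsCoeff n 0 = 1
rhsCoeff n 1 = 2 * (n ∸ 1)
rhsCoeff n 2 = n * n + 1 ∸ 3 * n
rhsCoeff n (suc (suc (suc _))) = 0

module Submission where

-- For k = n − 2 the only k-steps are the pairs (1, n − 1) and (2, n). A pair (a, b) with
-- b − a = k contributes nothing when π(b) is the maximum of π on [a, b], and exactly 1
-- otherwise: either it is an inversion, or π(a) < π(b) and the position of the maximum of π
-- strictly between a and b is its unique certificate. Each of the two windows misses a single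
-- position e, so π(b) is maximal on it iff π(b) = n, or π(b) = n − 1 and π(e) = n. Thus
-- ipcni_{n−2}(π) counts which of two events A, B fail, where |A| = |B| = n (n − 2)! and
-- |A ∩ B| = (n − 2)! (forced by π(n − 1) = n − 1, π(n) = n); inclusion–exclusion over the
-- n! permutations gives the coefficients (n − 2)!, 2 (n − 1) (n − 2)! and (n² − 3n + 1) (n − 2)!.

open import Defs
open import Data.Nat using (ℕ; _≤_; _*_; _+_; _∸_)
open import Data.Nat using (_!)
open import Data.Product using (_×_)
open import Relation.Binary.PropositionalEquality using (_≡_)

open import Data.Nat using (zero; suc; _<_; _≡ᵇ_; _<ᵇ_; z≤n; s≤s; s≤s⁻¹; z<s; s<s)
open import Data.Nat.Properties
open import Data.Nat.Solver using (module +-*-Solver)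
open +-*-Solver using (solve; _:+_; _:*_; _:=_; con)
open import Data.Bool using (Bool; true; false; _∧_; _∨_; not; T; T?)
open import Data.Bool.Properties using (∧-assoc; ∧-zeroʳ; ∧-identityʳ; ∨-identityʳ; T-∧; T-∨; T-≡)
open import Data.Unit using (tt)
open import Data.Empty using (⊥-elim)
open import Data.Product using (_,_; ∃; proj₁; proj₂)
open import Data.Sum using (_⊎_; inj₁; inj₂; [_,_])
open import Data.Fin as Fin using (Fin; toℕ; fromℕ; inject₁)
import Data.Fin.Properties as Fin
open import Data.Vec using (Vec; []; _∷_; lookup; _∷ʳ_)
open import Data.List using (List; []; _∷_; length; filterᵇ; concat; map; allFin; tabulate; _++_)
import Data.List.Properties as List
open import Function using (_∘_; id; Equivalence)
open import Function.Definitions using (Injective)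
open import Relation.Nullary using (¬_; Dec; yes; no; does)
open import Relation.Nullary.Decidable using (dec-true; dec-false)
open import Relation.Binary.Definitions using (tri<; tri≈; tri>)
open import Relation.Binary.PropositionalEquality
  using (refl; sym; trans; cong; cong₂; subst; subst₂; _≢_; module ≡-Reasoning)
open import Algebra.Properties.Semiring.Sum +-*-semiring
  using (sum; sum-syntax; sum-cong-≗; ∑-distrib-+; ∑-comm; *-distribʳ-sum)
open import Algebra.Properties.CommutativeSemigroup +-commutativeSemigroup
  using () renaming (interchange to +-interchange)

𝟙 : Bool → ℕ
𝟙 true = 1
𝟙 false = 0

∧-intro : ∀ {x y} → T x → T y → T (x ∧ y)
∧-intro tx ty = Equivalence.from T-∧ (tx , ty)

∧-elim : ∀ {x y} → T (x ∧ y) → T x × T y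
∧-elim = Equivalence.to T-∧

T-not⇒¬T : ∀ {x} → T (not x) → ¬ T x
T-not⇒¬T {true} ()

¬T⇒T-not : ∀ {x} → ¬ T x → T (not x)
¬T⇒T-not {true} ¬tx = ¬tx tt
¬T⇒T-not {false} _ = tt

T-ext : ∀ {x y} → (T x → T y) → (T y → T x) → x ≡ y
T-ext {true} {true} _ _ = refl
T-ext {true} {false} x⇒y _ = ⊥-elim (x⇒y tt)
T-ext {false} {true} _ y⇒x = ⊥-elim (y⇒x tt)
T-ext {false} {false} _ _ = refl

𝟙-T : ∀ {x} → T x → 𝟙 x ≡ 1
𝟙-T {true} _ = refl

𝟙-¬T : ∀ {x} → ¬ T x → 𝟙 x ≡ 0
𝟙-¬T {true} ¬tx = ⊥-elim (¬tx tt)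
𝟙-¬T {false} _ = refl

sum-zero : ∀ {N} (f : Fin N → ℕ) → (∀ i → f i ≡ 0) → sum f ≡ 0
sum-zero {zero} f f≡0 = refl
sum-zero {suc N} f f≡0 = cong₂ _+_ (f≡0 Fin.zero) (sum-zero (f ∘ Fin.suc) (f≡0 ∘ Fin.suc))

sum-single : ∀ {N} (f : Fin N → ℕ) b → (∀ i → i ≢ b → f i ≡ 0) → sum f ≡ f b
sum-single {suc N} f Fin.zero f≡0 =
  trans (cong (f Fin.zero +_) (sum-zero (f ∘ Fin.suc) (λ i → f≡0 (Fin.suc i) λ ()))) (+-identityʳ _)
sum-single {suc N} f (Fin.suc b) f≡0 =
  trans (cong (_+ sum (f ∘ Fin.suc)) (f≡0 Fin.zero λ ()))
        (sum-single (f ∘ Fin.suc) b (λ i i≢b → f≡0 (Fin.suc i) (i≢b ∘ Fin.suc-injective)))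

sum-const : ∀ N c → ∑[ _ < N ] c ≡ N * c
sum-const zero c = refl
sum-const (suc N) c = cong (c +_) (sum-const N c)

sum-*ʳ : ∀ {N} (f : Fin N → ℕ) c → ∑[ i < N ] (f i * c) ≡ sum f * c
sum-*ʳ f c = sym (*-distribʳ-sum c f)

sumL-map-tabulate : ∀ {A : Set} {N} (f : A → ℕ) (h : Fin N → A) → sumL (map f (tabulate h)) ≡ sum (f ∘ h)
sumL-map-tabulate {N = zero} f h = refl
sumL-map-tabulate {N = suc N} f h = cong (f (h Fin.zero) +_) (sumL-map-tabulate {N = N} f (h ∘ Fin.suc))

sumL-map-+ : ∀ {A : Set} (f g : A → ℕ) xs → sumL (map (λ x → f x + g x) xs) ≡ sumL (map f xs) + sumL (map g xs)
sumL-map-+ f g [] = refl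
sumL-map-+ f g (x ∷ xs) =
  trans (cong (f x + g x +_) (sumL-map-+ f g xs)) (+-interchange (f x) (g x) _ _)

sumL-map-cong : ∀ {A : Set} {f g : A → ℕ} → (∀ x → f x ≡ g x) → ∀ xs → sumL (map f xs) ≡ sumL (map g xs)
sumL-map-cong f≗g [] = refl
sumL-map-cong f≗g (x ∷ xs) = cong₂ _+_ (f≗g x) (sumL-map-cong f≗g xs)

count-∷ : ∀ {A : Set} (p : A → Bool) x xs → count p (x ∷ xs) ≡ 𝟙 (p x) + count p xs
count-∷ p x xs with p x
... | true = refl
... | false = refl

count≡sumL : ∀ {A : Set} (p : A → Bool) xs → count p xs ≡ sumL (map (𝟙 ∘ p) xs)
count≡sumL p [] = refl
count≡sumL p (x ∷ xs) = trans (count-∷ p x xs) (cong (𝟙 (p x) +_) (count≡sumL p xs))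

sumL-map-allFin : ∀ N (f : Fin N → ℕ) → sumL (map f (allFin N)) ≡ sum f
sumL-map-allFin N f = sumL-map-tabulate f id

count-allFin : ∀ {N} (p : Fin N → Bool) → count p (allFin N) ≡ ∑[ i < N ] 𝟙 (p i)
count-allFin {N} p = trans (count≡sumL p (allFin N)) (sumL-map-allFin N (𝟙 ∘ p))

count-++ : ∀ {A : Set} (p : A → Bool) xs ys → count p (xs ++ ys) ≡ count p xs + count p ys
count-++ p xs ys = trans (cong length (List.filter-++ (T? ∘ p) xs ys)) (List.length-++ (filterᵇ p xs))

count-map : ∀ {A B : Set} (p : B → Bool) (g : A → B) xs → count p (map g xs) ≡ count (p ∘ g) xs
count-map p g [] = refl
count-map p g (x ∷ xs) =
  trans (count-∷ p (g x) _) (trans (cong (𝟙 (p (g x)) +_) (count-map p g xs)) (sym (count-∷ (p ∘ g) x xs)))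

count-concat : ∀ {A : Set} (p : A → Bool) xss → count p (concat xss) ≡ sumL (map (count p) xss)
count-concat p [] = refl
count-concat p (xs ∷ xss) = trans (count-++ p xs (concat xss)) (cong (count p xs +_) (count-concat p xss))

count-filterᵇ : ∀ {A : Set} (p q : A → Bool) xs → count p (filterᵇ q xs) ≡ count (λ x → q x ∧ p x) xs
count-filterᵇ p q [] = refl
count-filterᵇ p q (x ∷ xs) rewrite count-∷ (λ x → q x ∧ p x) x xs with q x
... | true  = trans (count-∷ p x (filterᵇ q xs)) (cong (𝟙 (p x) +_) (count-filterᵇ p q xs))
... | false = count-filterᵇ p q xs

count-false : ∀ {A : Set} (xs : List A) → count (λ _ → false) xs ≡ 0
count-false [] = refl
count-false (x ∷ xs) = count-false xs

count-cong : ∀ {A : Set} {p q : A → Bool} → (∀ x → p x ≡ q x) → ∀ xs → count p xs ≡ count q xs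
count-cong {p = p} {q} p≗q xs = trans (count≡sumL p xs) (trans (sumL-map-cong (cong 𝟙 ∘ p≗q) xs) (sym (count≡sumL q xs)))

count-∧-const : ∀ {A : Set} (p : A → Bool) c xs → count (λ x → p x ∧ c) xs ≡ 𝟙 c * count p xs
count-∧-const p true xs = trans (count-cong (λ x → ∧-identityʳ (p x)) xs) (sym (+-identityʳ _))
count-∧-const p false xs = trans (count-cong (λ x → ∧-zeroʳ (p x)) xs) (count-false xs)

count-+ : ∀ {A : Set} (p q : A → Bool) xs → count p xs + count q xs ≡ sumL (map (λ x → 𝟙 (p x) + 𝟙 (q x)) xs)
count-+ p q xs = trans (cong₂ _+_ (count≡sumL p xs) (count≡sumL q xs)) (sym (sumL-map-+ (𝟙 ∘ p) (𝟙 ∘ q) xs))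

allᵇ-tabulate⇒ : ∀ {A : Set} {N} (p : A → Bool) (h : Fin N → A) → T (allᵇ p (tabulate h)) → ∀ i → T (p (h i))
allᵇ-tabulate⇒ p h t Fin.zero = proj₁ (∧-elim t)
allᵇ-tabulate⇒ p h t (Fin.suc i) = allᵇ-tabulate⇒ p (h ∘ Fin.suc) (proj₂ (∧-elim t)) i

allᵇ-tabulate⇐ : ∀ {A : Set} {N} (p : A → Bool) (h : Fin N → A) → (∀ i → T (p (h i))) → T (allᵇ p (tabulate h))
allᵇ-tabulate⇐ {N = zero} p h _ = tt
allᵇ-tabulate⇐ {N = suc N} p h all = ∧-intro (all Fin.zero) (allᵇ-tabulate⇐ p (h ∘ Fin.suc) (all ∘ Fin.suc))

allᵇ-tabulate-¬ : ∀ {A : Set} {N} (p : A → Bool) (h : Fin N → A) → ¬ T (allᵇ p (tabulate h)) → ∃ λ i → ¬ T (p (h i))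
allᵇ-tabulate-¬ {N = zero} p h ¬all = ⊥-elim (¬all tt)
allᵇ-tabulate-¬ {N = suc N} p h ¬all with T? (p (h Fin.zero))
... | no ¬p0 = Fin.zero , ¬p0
... | yes p0 with allᵇ-tabulate-¬ p (h ∘ Fin.suc) (¬all ∘ ∧-intro p0)
...   | i , ¬pi = Fin.suc i , ¬pi

-- Two events

failures : ∀ {A : Set} → (A → Bool) → (A → Bool) → A → ℕ
failures p q x = 𝟙 (not (p x)) + 𝟙 (not (q x))

module _ {A : Set} (p q : A → Bool) (xs : List A) where

  exactly : ℕ → ℕ
  exactly j = count (λ x → failures p q x ≡ᵇ j) xs

  both : ℕ
  both = count (λ x → p x ∧ q x) xs

  exactly-0 : exactly 0 ≡ both
  exactly-0 = count-cong pointwise xs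
    where
    pointwise : ∀ x → (failures p q x ≡ᵇ 0) ≡ (p x ∧ q x)
    pointwise x with p x | q x
    ... | true  | true  = refl
    ... | true  | false = refl
    ... | false | _     = refl

  exactly-1 : exactly 1 + (both + both) ≡ count p xs + count q xs
  exactly-1 = begin
    exactly 1 + (both + both)
      ≡⟨ cong₂ _+_ (count≡sumL _ xs) (count-+ (λ x → p x ∧ q x) (λ x → p x ∧ q x) xs) ⟩
    sumL (map (λ x → 𝟙 (failures p q x ≡ᵇ 1)) xs) + sumL (map (λ x → 𝟙 (p x ∧ q x) + 𝟙 (p x ∧ q x)) xs)
      ≡⟨ sumL-map-+ (λ x → 𝟙 (failures p q x ≡ᵇ 1)) _ xs ⟨
    sumL (map (λ x → 𝟙 (failures p q x ≡ᵇ 1) + (𝟙 (p x ∧ q x) + 𝟙 (p x ∧ q x))) xs)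
      ≡⟨ sumL-map-cong pointwise xs ⟩
    sumL (map (λ x → 𝟙 (p x) + 𝟙 (q x)) xs)
      ≡⟨ count-+ p q xs ⟨
    count p xs + count q xs
      ∎
    where
    open ≡-Reasoning
    pointwise : ∀ x → 𝟙 (failures p q x ≡ᵇ 1) + (𝟙 (p x ∧ q x) + 𝟙 (p x ∧ q x)) ≡ 𝟙 (p x) + 𝟙 (q x)
    pointwise x with p x | q x
    ... | true  | true  = refl
    ... | true  | false = refl
    ... | false | true  = refl
    ... | false | false = refl

  exactly-2 : exactly 2 + (count p xs + count q xs) ≡ count (λ _ → true) xs + both
  exactly-2 = begin
    exactly 2 + (count p xs + count q xs)
      ≡⟨ cong₂ _+_ (count≡sumL _ xs) (count-+ p q xs) ⟩
    sumL (map (λ x → 𝟙 (failures p q x ≡ᵇ 2)) xs) + sumL (map (λ x → 𝟙 (p x) + 𝟙 (q x)) xs)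
      ≡⟨ sumL-map-+ (λ x → 𝟙 (failures p q x ≡ᵇ 2)) _ xs ⟨
    sumL (map (λ x → 𝟙 (failures p q x ≡ᵇ 2) + (𝟙 (p x) + 𝟙 (q x))) xs)
      ≡⟨ sumL-map-cong pointwise xs ⟩
    sumL (map (λ x → 𝟙 true + 𝟙 (p x ∧ q x)) xs)
      ≡⟨ count-+ (λ _ → true) (λ x → p x ∧ q x) xs ⟨
    count (λ _ → true) xs + both
      ∎
    where
    open ≡-Reasoning
    pointwise : ∀ x → 𝟙 (failures p q x ≡ᵇ 2) + (𝟙 (p x) + 𝟙 (q x)) ≡ 𝟙 true + 𝟙 (p x ∧ q x)
    pointwise x with p x | q x
    ... | true  | true  = refl
    ... | true  | false = refl
    ... | false | true  = refl
    ... | false | false = refl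

  exactly-3+ : ∀ j → exactly (3 + j) ≡ 0
  exactly-3+ j = trans (count-cong pointwise xs) (count-false xs)
    where
    pointwise : ∀ x → (failures p q x ≡ᵇ 3 + j) ≡ false
    pointwise x with p x | q x
    ... | true  | true  = refl
    ... | true  | false = refl
    ... | false | true  = refl
    ... | false | false = refl

largest : ∀ n → Fin (2 + n)
largest n = fromℕ (suc n)

secondLargest : ∀ n → Fin (2 + n)
secondLargest n = inject₁ (fromℕ n)

lookup-∷ʳ-last : ∀ {A : Set} {n} (v : Vec A n) x → lookup (v ∷ʳ x) (fromℕ n) ≡ x
lookup-∷ʳ-last [] x = refl
lookup-∷ʳ-last (y ∷ v) x = lookup-∷ʳ-last v x

lookup-∷ʳ-inject₁ : ∀ {A : Set} {n} (v : Vec A n) x i → lookup (v ∷ʳ x) (inject₁ i) ≡ lookup v i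
lookup-∷ʳ-inject₁ (y ∷ v) x Fin.zero = refl
lookup-∷ʳ-inject₁ (y ∷ v) x (Fin.suc i) = lookup-∷ʳ-inject₁ v x i

count-vecs-∷ : ∀ N k (p : Vec (Fin N) (suc k) → Bool) →
  count p (vecs N (suc k)) ≡ ∑[ x < N ] count (λ v → p (x ∷ v)) (vecs N k)
count-vecs-∷ N k p = begin
  count p (concat (map extend (allFin N)))       ≡⟨ count-concat p (map extend (allFin N)) ⟩
  sumL (map (count p) (map extend (allFin N)))   ≡⟨ cong sumL (List.map-∘ (allFin N)) ⟨
  sumL (map (count p ∘ extend) (allFin N))       ≡⟨ sumL-map-allFin N (count p ∘ extend) ⟩
  ∑[ x < N ] count p (extend x)                  ≡⟨ sum-cong-≗ (λ x → count-map p (x ∷_) (vecs N k)) ⟩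
  ∑[ x < N ] count (λ v → p (x ∷ v)) (vecs N k)  ∎
  where
  open ≡-Reasoning
  extend : Fin N → List (Vec (Fin N) (suc k))
  extend x = map (x ∷_) (vecs N k)

count-vecs-∷ʳ : ∀ N k (p : Vec (Fin N) (suc k) → Bool) →
  count p (vecs N (suc k)) ≡ ∑[ x < N ] count (λ v → p (v ∷ʳ x)) (vecs N k)
count-vecs-∷ʳ N zero p = trans (count-vecs-∷ N zero p) (sum-cong-≗ {N} singleton)
  where
  singleton : ∀ x → count (λ v → p (x ∷ v)) (vecs N 0) ≡ count (λ v → p (v ∷ʳ x)) (vecs N 0)
  singleton x = trans (count-∷ (λ v → p (x ∷ v)) [] []) (sym (count-∷ (λ v → p (v ∷ʳ x)) [] []))
count-vecs-∷ʳ N (suc k) p = begin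
  count p (vecs N (suc (suc k)))                      ≡⟨ count-vecs-∷ N (suc k) p ⟩
  ∑[ y < N ] count (λ v → p (y ∷ v)) (vecs N (suc k)) ≡⟨ sum-cong-≗ (λ y → count-vecs-∷ʳ N k (λ v → p (y ∷ v))) ⟩
  ∑[ y < N ] ∑[ x < N ] inner y x                     ≡⟨ ∑-comm inner ⟩
  ∑[ x < N ] ∑[ y < N ] inner y x                     ≡⟨ sum-cong-≗ (λ x → count-vecs-∷ N k (λ v → p (v ∷ʳ x))) ⟨
  ∑[ x < N ] count (λ v → p (v ∷ʳ x)) (vecs N (suc k)) ∎
  where
  open ≡-Reasoning
  inner : Fin N → Fin N → ℕ
  inner y x = count (λ v → p (y ∷ (v ∷ʳ x))) (vecs N k)

_=ᶠ_ : ∀ {N} → Fin N → Fin N → Bool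
x =ᶠ y = does (x Fin.≟ y)

T-=ᶠ : ∀ {N} {x y : Fin N} → T (x =ᶠ y) → x ≡ y
T-=ᶠ {x = x} {y} t with x Fin.≟ y
... | yes x≡y = x≡y

≡⇒T-=ᶠ : ∀ {N} {x y : Fin N} → x ≡ y → T (x =ᶠ y)
≡⇒T-=ᶠ {x = x} {y} x≡y with x Fin.≟ y
... | yes _ = tt
... | no x≢y = x≢y x≡y

≢⇒¬T-=ᶠ : ∀ {N} {x y : Fin N} → x ≢ y → ¬ T (x =ᶠ y)
≢⇒¬T-=ᶠ x≢y = x≢y ∘ T-=ᶠ

=ᶠ-sym : ∀ {N} (x y : Fin N) → (x =ᶠ y) ≡ (y =ᶠ x)
=ᶠ-sym x y with x Fin.≟ y | y Fin.≟ x
... | yes _   | yes _   = refl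
... | no _    | no _    = refl
... | yes x≡y | no y≢x  = ⊥-elim (y≢x (sym x≡y))
... | no x≢y  | yes y≡x = ⊥-elim (x≢y (sym y≡x))

avoidsᵇ : ∀ {N k} → (Fin N → Bool) → Vec (Fin N) k → Bool
avoidsᵇ F [] = true
avoidsᵇ F (x ∷ v) = not (F x) ∧ avoidsᵇ F v

distinctᵇ : ∀ {N k} → Vec (Fin N) k → Bool
distinctᵇ [] = true
distinctᵇ (x ∷ v) = avoidsᵇ (x =ᶠ_) v ∧ distinctᵇ v

allowed : ∀ {N} → (Fin N → Bool) → ℕ
allowed {N} F = ∑[ y < N ] 𝟙 (not (F y))

avoidsᵇ⇒ : ∀ {N k} (F : Fin N → Bool) (v : Vec (Fin N) k) → T (avoidsᵇ F v) → ∀ i → ¬ T (F (lookup v i))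
avoidsᵇ⇒ F (x ∷ v) t Fin.zero = T-not⇒¬T (proj₁ (∧-elim t))
avoidsᵇ⇒ F (x ∷ v) t (Fin.suc i) = avoidsᵇ⇒ F v (proj₂ (∧-elim t)) i

avoidsᵇ⇐ : ∀ {N k} (F : Fin N → Bool) (v : Vec (Fin N) k) → (∀ i → ¬ T (F (lookup v i))) → T (avoidsᵇ F v)
avoidsᵇ⇐ F [] _ = tt
avoidsᵇ⇐ F (x ∷ v) none = ∧-intro (¬T⇒T-not (none Fin.zero)) (avoidsᵇ⇐ F v (none ∘ Fin.suc))

distinctᵇ⇒ : ∀ {N k} (v : Vec (Fin N) k) → T (distinctᵇ v) → Injective _≡_ _≡_ (lookup v)
distinctᵇ⇒ (x ∷ v) t {Fin.zero} {Fin.zero} _ = refl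
distinctᵇ⇒ (x ∷ v) t {Fin.zero} {Fin.suc j} x≡vj = ⊥-elim (avoidsᵇ⇒ (x =ᶠ_) v (proj₁ (∧-elim t)) j (≡⇒T-=ᶠ x≡vj))
distinctᵇ⇒ (x ∷ v) t {Fin.suc i} {Fin.zero} vi≡x = ⊥-elim (avoidsᵇ⇒ (x =ᶠ_) v (proj₁ (∧-elim t)) i (≡⇒T-=ᶠ (sym vi≡x)))
distinctᵇ⇒ (x ∷ v) t {Fin.suc i} {Fin.suc j} vi≡vj = cong Fin.suc (distinctᵇ⇒ v (proj₂ (∧-elim t)) vi≡vj)

distinctᵇ⇐ : ∀ {N k} (v : Vec (Fin N) k) → Injective _≡_ _≡_ (lookup v) → T (distinctᵇ v)
distinctᵇ⇐ [] _ = tt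
distinctᵇ⇐ (x ∷ v) inj = ∧-intro
  (avoidsᵇ⇐ (x =ᶠ_) v (λ i → ≢⇒¬T-=ᶠ (Fin.0≢1+n ∘ inj {Fin.zero} {Fin.suc i})))
  (distinctᵇ⇐ v (Fin.suc-injective ∘ inj))

avoidsᵇ-∨ : ∀ {N k} (F G : Fin N → Bool) (v : Vec (Fin N) k) →
  avoidsᵇ (λ y → F y ∨ G y) v ≡ avoidsᵇ F v ∧ avoidsᵇ G v
avoidsᵇ-∨ F G [] = refl
avoidsᵇ-∨ F G (x ∷ v) with F x | G x
... | true  | _     = refl
... | false | true  = sym (∧-zeroʳ (avoidsᵇ F v))
... | false | false = avoidsᵇ-∨ F G v

avoidsᵇ-∷ʳ : ∀ {N k} (F : Fin N → Bool) (v : Vec (Fin N) k) x → avoidsᵇ F (v ∷ʳ x) ≡ avoidsᵇ F v ∧ not (F x)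
avoidsᵇ-∷ʳ F [] x = ∧-identityʳ (not (F x))
avoidsᵇ-∷ʳ F (y ∷ v) x = trans (cong (not (F y) ∧_) (avoidsᵇ-∷ʳ F v x)) (sym (∧-assoc (not (F y)) _ _))

distinctᵇ-∷ʳ : ∀ {N k} (v : Vec (Fin N) k) x → distinctᵇ (v ∷ʳ x) ≡ avoidsᵇ (x =ᶠ_) v ∧ distinctᵇ v
distinctᵇ-∷ʳ [] x = refl
distinctᵇ-∷ʳ (y ∷ v) x = begin
  avoidsᵇ (y =ᶠ_) (v ∷ʳ x) ∧ distinctᵇ (v ∷ʳ x)
    ≡⟨ cong₂ _∧_ (avoidsᵇ-∷ʳ (y =ᶠ_) v x) (distinctᵇ-∷ʳ v x) ⟩
  (avoidsᵇ (y =ᶠ_) v ∧ not (y =ᶠ x)) ∧ (avoidsᵇ (x =ᶠ_) v ∧ distinctᵇ v)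
    ≡⟨ cong (λ e → (avoidsᵇ (y =ᶠ_) v ∧ not e) ∧ _) (=ᶠ-sym y x) ⟩
  (avoidsᵇ (y =ᶠ_) v ∧ not (x =ᶠ y)) ∧ (avoidsᵇ (x =ᶠ_) v ∧ distinctᵇ v)
    ≡⟨ swap-middle (avoidsᵇ (y =ᶠ_) v) (not (x =ᶠ y)) (avoidsᵇ (x =ᶠ_) v) (distinctᵇ v) ⟩
  (not (x =ᶠ y) ∧ avoidsᵇ (x =ᶠ_) v) ∧ (avoidsᵇ (y =ᶠ_) v ∧ distinctᵇ v)
    ∎
  where
  open ≡-Reasoning
  swap-middle : ∀ a e b c → (a ∧ e) ∧ (b ∧ c) ≡ (e ∧ b) ∧ (a ∧ c)
  swap-middle true  e b c = sym (∧-assoc e b c)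
  swap-middle false true b c = sym (∧-zeroʳ b)
  swap-middle false false b c = refl

avoidsᵇ-nothing : ∀ {N k} (v : Vec (Fin N) k) → avoidsᵇ (λ _ → false) v ≡ true
avoidsᵇ-nothing [] = refl
avoidsᵇ-nothing (x ∷ v) = avoidsᵇ-nothing v

allowed-remove : ∀ {N} (F : Fin N → Bool) x → F x ≡ false → allowed (λ y → F y ∨ (x =ᶠ y)) + 1 ≡ allowed F
allowed-remove {N} F x Fx≡false = begin
  allowed F′ + 1                                     ≡⟨ cong (allowed F′ +_) onlyAtX ⟨
  allowed F′ + ∑[ y < N ] 𝟙 (x =ᶠ y)                 ≡⟨ ∑-distrib-+ (λ y → 𝟙 (not (F′ y))) (λ y → 𝟙 (x =ᶠ y)) ⟨
  ∑[ y < N ] (𝟙 (not (F′ y)) + 𝟙 (x =ᶠ y))           ≡⟨ sum-cong-≗ split ⟩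
  allowed F                                          ∎
  where
  open ≡-Reasoning
  F′ : Fin N → Bool
  F′ y = F y ∨ (x =ᶠ y)
  onlyAtX : ∑[ y < N ] 𝟙 (x =ᶠ y) ≡ 1
  onlyAtX = trans (sum-single (λ y → 𝟙 (x =ᶠ y)) x λ y y≢x → cong 𝟙 (dec-false (x Fin.≟ y) (y≢x ∘ sym)))
                  (cong 𝟙 (dec-true (x Fin.≟ x) refl))
  split : ∀ y → 𝟙 (not (F′ y)) + 𝟙 (x =ᶠ y) ≡ 𝟙 (not (F y))
  split y with x Fin.≟ y
  ... | yes refl rewrite Fx≡false = refl
  ... | no _ = trans (+-identityʳ _) (cong (𝟙 ∘ not) (∨-identityʳ (F y)))

allowed-none : ∀ N → allowed {N} (λ _ → false) ≡ N
allowed-none N = trans (sum-const N 1) (*-identityʳ N)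

count-distinct-avoiding : ∀ {N} k (F : Fin N → Bool) → allowed F ≡ k →
  count (λ v → avoidsᵇ F v ∧ distinctᵇ v) (vecs N k) ≡ k !
count-distinct-avoiding zero F _ = refl
count-distinct-avoiding {N} (suc k) F allowed≡ = begin
  count P (vecs N (suc k))                  ≡⟨ count-vecs-∷ N k P ⟩
  ∑[ x < N ] count (P ∘ (x ∷_)) (vecs N k)  ≡⟨ sum-cong-≗ headCount ⟩
  ∑[ x < N ] (𝟙 (not (F x)) * k !)          ≡⟨ *-distribʳ-sum (k !) (λ x → 𝟙 (not (F x))) ⟨
  allowed F * k !                           ≡⟨ cong (_* k !) allowed≡ ⟩
  suc k * k !                               ∎
  where
  open ≡-Reasoning
  P : Vec (Fin N) (suc k) → Bool
  P v = avoidsᵇ F v ∧ distinctᵇ v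
  headCount : ∀ x → count (P ∘ (x ∷_)) (vecs N k) ≡ 𝟙 (not (F x)) * k !
  headCount x with F x in Fx
  ... | true = count-false (vecs N k)
  ... | false = begin
    count (λ v → avoidsᵇ F v ∧ (avoidsᵇ (x =ᶠ_) v ∧ distinctᵇ v)) (vecs N k) ≡⟨ count-cong regroup (vecs N k) ⟩
    count (λ v → avoidsᵇ F′ v ∧ distinctᵇ v) (vecs N k)    ≡⟨ count-distinct-avoiding k F′ allowedF′ ⟩
    k !                                                    ≡⟨ +-identityʳ (k !) ⟨
    1 * k !                                                ∎
    where
    F′ : Fin N → Bool
    F′ y = F y ∨ (x =ᶠ y)
    regroup : ∀ v → avoidsᵇ F v ∧ (avoidsᵇ (x =ᶠ_) v ∧ distinctᵇ v) ≡ avoidsᵇ F′ v ∧ distinctᵇ v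
    regroup v = trans (sym (∧-assoc (avoidsᵇ F v) _ _)) (cong (_∧ distinctᵇ v) (sym (avoidsᵇ-∨ F (x =ᶠ_) v)))
    allowedF′ : allowed F′ ≡ k
    allowedF′ = +-cancelʳ-≡ 1 (allowed F′) k (trans (allowed-remove F x Fx) (trans allowed≡ (+-comm 1 k)))

-- The predicate is distinctᵇ of a vector with outer entries a and b, unfolded around σ,
-- together with a constraint c on (a, b).
count-distinct-avoiding-pair : ∀ k (a b : Fin (2 + k)) c →
  count (λ σ → ((avoidsᵇ (a =ᶠ_) σ ∧ not (a =ᶠ b)) ∧ (avoidsᵇ (b =ᶠ_) σ ∧ distinctᵇ σ)) ∧ c) (vecs (2 + k) k)
    ≡ 𝟙 (not (a =ᶠ b) ∧ c) * k !
count-distinct-avoiding-pair k a b c = begin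
  count (λ σ → ((avoidsᵇ (a =ᶠ_) σ ∧ not (a =ᶠ b)) ∧ (avoidsᵇ (b =ᶠ_) σ ∧ distinctᵇ σ)) ∧ c) (vecs (2 + k) k)
    ≡⟨ count-cong regroup (vecs (2 + k) k) ⟩
  count (λ σ → (avoidsᵇ ab σ ∧ distinctᵇ σ) ∧ (not (a =ᶠ b) ∧ c)) (vecs (2 + k) k)
    ≡⟨ count-∧-const (λ σ → avoidsᵇ ab σ ∧ distinctᵇ σ) _ (vecs (2 + k) k) ⟩
  𝟙 (not (a =ᶠ b) ∧ c) * count (λ σ → avoidsᵇ ab σ ∧ distinctᵇ σ) (vecs (2 + k) k)
    ≡⟨ distinct ⟩
  𝟙 (not (a =ᶠ b) ∧ c) * k !
    ∎
  where
  open ≡-Reasoning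
  ab : Fin (2 + k) → Bool
  ab y = (a =ᶠ y) ∨ (b =ᶠ y)
  shuffle : ∀ p e q r → ((p ∧ e) ∧ (q ∧ r)) ∧ c ≡ ((p ∧ q) ∧ r) ∧ (e ∧ c)
  shuffle false e q r = refl
  shuffle true true q r = refl
  shuffle true false q r = sym (∧-zeroʳ ((q ∧ r)))
  regroup : ∀ σ → ((avoidsᵇ (a =ᶠ_) σ ∧ not (a =ᶠ b)) ∧ (avoidsᵇ (b =ᶠ_) σ ∧ distinctᵇ σ)) ∧ c
                ≡ (avoidsᵇ ab σ ∧ distinctᵇ σ) ∧ (not (a =ᶠ b) ∧ c)
  regroup σ = trans (shuffle (avoidsᵇ (a =ᶠ_) σ) (not (a =ᶠ b)) (avoidsᵇ (b =ᶠ_) σ) (distinctᵇ σ))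
                    (cong (λ z → (z ∧ distinctᵇ σ) ∧ (not (a =ᶠ b) ∧ c)) (sym (avoidsᵇ-∨ (a =ᶠ_) (b =ᶠ_) σ)))
  distinct : 𝟙 (not (a =ᶠ b) ∧ c) * count (λ σ → avoidsᵇ ab σ ∧ distinctᵇ σ) (vecs (2 + k) k)
           ≡ 𝟙 (not (a =ᶠ b) ∧ c) * k !
  distinct with a Fin.≟ b
  ... | yes _ = refl
  ... | no a≢b = cong (𝟙 c *_) (count-distinct-avoiding k ab allowed-ab)
    where
    allowed-ab : allowed ab ≡ k
    allowed-ab = +-cancelʳ-≡ 2 (allowed ab) k (begin
      allowed ab + 2             ≡⟨ +-assoc (allowed ab) 1 1 ⟨
      allowed ab + 1 + 1         ≡⟨ cong (_+ 1) (allowed-remove (a =ᶠ_) b (dec-false (a Fin.≟ b) a≢b)) ⟩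
      allowed (a =ᶠ_) + 1        ≡⟨ allowed-remove (λ _ → false) a refl ⟩
      allowed {2 + k} (λ _ → false) ≡⟨ allowed-none (2 + k) ⟩
      2 + k                      ≡⟨ +-comm 2 k ⟩
      k + 2                      ∎)

distinctPairs : ∀ {N} → (Fin N → Fin N → Bool) → ℕ
distinctPairs {N} R = ∑[ a < N ] ∑[ b < N ] 𝟙 (not (a =ᶠ b) ∧ R a b)

distinctPairs-*ʳ : ∀ {N} (R : Fin N → Fin N → Bool) c →
  ∑[ a < N ] ∑[ b < N ] (𝟙 (not (a =ᶠ b) ∧ R a b) * c) ≡ distinctPairs R * c
distinctPairs-*ʳ {N} R c =
  trans (sum-cong-≗ (λ a → sum-*ʳ (λ b → 𝟙 (not (a =ᶠ b) ∧ R a b)) c)) (sum-*ʳ (λ a → ∑[ b < N ] 𝟙 (not (a =ᶠ b) ∧ R a b)) c)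

countPerms : ∀ N → (Vec (Fin N) N → Bool) → ℕ
countPerms N P = count (λ π → distinctᵇ π ∧ P π) (vecs N N)

countPerms-lastTwo : ∀ k (R : Fin (2 + k) → Fin (2 + k) → Bool) →
  countPerms (2 + k) (λ π → R (lookup π (largest k)) (lookup π (secondLargest k))) ≡ distinctPairs R * k !
countPerms-lastTwo k R = begin
  count P (vecs N (2 + k))                                          ≡⟨ count-vecs-∷ʳ N (suc k) P ⟩
  ∑[ w < N ] count (λ ρ → P (ρ ∷ʳ w)) (vecs N (suc k))              ≡⟨ sum-cong-≗ (λ w → count-vecs-∷ʳ N k (λ ρ → P (ρ ∷ʳ w))) ⟩
  ∑[ w < N ] ∑[ u < N ] count (λ σ → P ((σ ∷ʳ u) ∷ʳ w)) (vecs N k)  ≡⟨ sum-cong-≗ (λ w → sum-cong-≗ (λ u → pairCount w u)) ⟩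
  ∑[ w < N ] ∑[ u < N ] (𝟙 (not (w =ᶠ u) ∧ R w u) * k !)           ≡⟨ distinctPairs-*ʳ R (k !) ⟩
  distinctPairs R * k !                                             ∎
  where
  open ≡-Reasoning
  N : ℕ
  N = 2 + k
  P : Vec (Fin N) N → Bool
  P π = distinctᵇ π ∧ R (lookup π (largest k)) (lookup π (secondLargest k))
  pairCount : ∀ w u → count (λ σ → P ((σ ∷ʳ u) ∷ʳ w)) (vecs N k) ≡ 𝟙 (not (w =ᶠ u) ∧ R w u) * k !
  pairCount w u = trans (count-cong unfold (vecs N k)) (count-distinct-avoiding-pair k w u (R w u))
    where
    unfold : ∀ σ → P ((σ ∷ʳ u) ∷ʳ w)
                 ≡ ((avoidsᵇ (w =ᶠ_) σ ∧ not (w =ᶠ u)) ∧ (avoidsᵇ (u =ᶠ_) σ ∧ distinctᵇ σ)) ∧ R w u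
    unfold σ rewrite lookup-∷ʳ-last (σ ∷ʳ u) w | lookup-∷ʳ-inject₁ (σ ∷ʳ u) w (fromℕ k) | lookup-∷ʳ-last σ u
      | distinctᵇ-∷ʳ (σ ∷ʳ u) w | distinctᵇ-∷ʳ σ u | avoidsᵇ-∷ʳ (w =ᶠ_) σ u = refl

countPerms-firstLast : ∀ k (R : Fin (2 + k) → Fin (2 + k) → Bool) →
  countPerms (2 + k) (λ π → R (lookup π Fin.zero) (lookup π (largest k))) ≡ distinctPairs R * k !
countPerms-firstLast k R = begin
  count P (vecs N (2 + k))                                          ≡⟨ count-vecs-∷ N (suc k) P ⟩
  ∑[ x < N ] count (λ ρ → P (x ∷ ρ)) (vecs N (suc k))               ≡⟨ sum-cong-≗ (λ x → count-vecs-∷ʳ N k (λ ρ → P (x ∷ ρ))) ⟩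
  ∑[ x < N ] ∑[ w < N ] count (λ σ → P (x ∷ (σ ∷ʳ w))) (vecs N k)   ≡⟨ sum-cong-≗ (λ x → sum-cong-≗ (λ w → pairCount x w)) ⟩
  ∑[ x < N ] ∑[ w < N ] (𝟙 (not (x =ᶠ w) ∧ R x w) * k !)           ≡⟨ distinctPairs-*ʳ R (k !) ⟩
  distinctPairs R * k !                                             ∎
  where
  open ≡-Reasoning
  N : ℕ
  N = 2 + k
  P : Vec (Fin N) N → Bool
  P π = distinctᵇ π ∧ R (lookup π Fin.zero) (lookup π (largest k))
  pairCount : ∀ x w → count (λ σ → P (x ∷ (σ ∷ʳ w))) (vecs N k) ≡ 𝟙 (not (x =ᶠ w) ∧ R x w) * k !
  pairCount x w = trans (count-cong unfold (vecs N k)) (count-distinct-avoiding-pair k x w (R x w))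
    where
    unfold : ∀ σ → P (x ∷ (σ ∷ʳ w))
                 ≡ ((avoidsᵇ (x =ᶠ_) σ ∧ not (x =ᶠ w)) ∧ (avoidsᵇ (w =ᶠ_) σ ∧ distinctᵇ σ)) ∧ R x w
    unfold σ rewrite lookup-∷ʳ-last σ w | distinctᵇ-∷ʳ σ w | avoidsᵇ-∷ʳ (x =ᶠ_) σ w = refl

countPerms-cong : ∀ N {P Q : Vec (Fin N) N → Bool} → (∀ π → T (distinctᵇ π) → P π ≡ Q π) → countPerms N P ≡ countPerms N Q
countPerms-cong N {P} {Q} P≗Q = count-cong guarded (vecs N N)
  where
  guarded : ∀ π → distinctᵇ π ∧ P π ≡ distinctᵇ π ∧ Q π
  guarded π with distinctᵇ π in distinct
  ... | true = P≗Q π (Equivalence.from T-≡ distinct)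
  ... | false = refl

injectiveᵇ-noCollision : ∀ {N} (π : Vec (Fin N) N) → T (injectiveᵇ π) → ∀ a b → toℕ a < toℕ b → val π a ≢ val π b
injectiveᵇ-noCollision {N} π t a b a<b πa≡πb
  with toℕ a <ᵇ toℕ b | <⇒<ᵇ a<b | val π a ≡ᵇ val π b | ≡⇒≡ᵇ (val π a) (val π b) πa≡πb
     | allᵇ-tabulate⇒ _ id (allᵇ-tabulate⇒ _ id t a) b
... | true | _ | true | _ | ()

injectiveᵇ⇒ : ∀ {N} (π : Vec (Fin N) N) → T (injectiveᵇ π) → Injective _≡_ _≡_ (lookup π)
injectiveᵇ⇒ {N} π t {i} {j} πi≡πj with <-cmp (toℕ i) (toℕ j)
... | tri< i<j _ _ = ⊥-elim (injectiveᵇ-noCollision π t i j i<j (cong toℕ πi≡πj))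
... | tri≈ _ i≡j _ = Fin.toℕ-injective i≡j
... | tri> _ _ j<i = ⊥-elim (injectiveᵇ-noCollision π t j i j<i (cong toℕ (sym πi≡πj)))

-- The entries of injectiveᵇ use a disjunction local to Defs, so a failing entry is refuted
-- rather than each entry proved.
injectiveᵇ⇐ : ∀ {N} (π : Vec (Fin N) N) → Injective _≡_ _≡_ (lookup π) → T (injectiveᵇ π)
injectiveᵇ⇐ π inj with T? (injectiveᵇ π)
... | yes t = t
... | no ¬t with allᵇ-tabulate-¬ _ id ¬t
...   | a , ¬row with allᵇ-tabulate-¬ _ id ¬row
...     | b , ¬entry with toℕ a <ᵇ toℕ b in a<ᵇb | val π a ≡ᵇ val π b in πa≡ᵇπb
...       | false | _     = ⊥-elim (¬entry tt)
...       | true  | false = ⊥-elim (¬entry tt)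
...       | true  | true  = ⊥-elim (<-irrefl (cong toℕ (inj (Fin.toℕ-injective πa≡πb))) a<b)
  where
  a<b : toℕ a < toℕ b
  a<b = <ᵇ⇒< (toℕ a) (toℕ b) (Equivalence.from T-≡ a<ᵇb)
  πa≡πb : val π a ≡ val π b
  πa≡πb = ≡ᵇ⇒≡ (val π a) (val π b) (Equivalence.from T-≡ πa≡ᵇπb)

injectiveᵇ≡distinctᵇ : ∀ {N} (π : Vec (Fin N) N) → injectiveᵇ π ≡ distinctᵇ π
injectiveᵇ≡distinctᵇ π = T-ext (distinctᵇ⇐ π ∘ injectiveᵇ⇒ π) (injectiveᵇ⇐ π ∘ distinctᵇ⇒ π)

count-S : ∀ N (P : Vec (Fin N) N → Bool) → count P (S N) ≡ countPerms N P
count-S N P =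
  trans (count-filterᵇ P injectiveᵇ (vecs N N)) (count-cong (λ π → cong (_∧ P π) (injectiveᵇ≡distinctᵇ π)) (vecs N N))

count-S-all : ∀ N → count (λ _ → true) (S N) ≡ N !
count-S-all N = begin
  count (λ _ → true) (S N)                                       ≡⟨ count-S N (λ _ → true) ⟩
  count (λ π → distinctᵇ π ∧ true) (vecs N N)                     ≡⟨ count-cong unconstrained (vecs N N) ⟩
  count (λ π → avoidsᵇ (λ _ → false) π ∧ distinctᵇ π) (vecs N N)  ≡⟨ count-distinct-avoiding N (λ _ → false) (allowed-none N) ⟩
  N !                                                            ∎
  where
  open ≡-Reasoning
  unconstrained : ∀ π → distinctᵇ π ∧ true ≡ avoidsᵇ (λ _ → false) π ∧ distinctᵇ π
  unconstrained π = trans (∧-identityʳ (distinctᵇ π)) (cong (_∧ distinctᵇ π) (sym (avoidsᵇ-nothing π)))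

injective⇒surjective : ∀ {N} (f : Fin N → Fin N) → Injective _≡_ _≡_ f → ∀ y → ∃ λ x → f x ≡ y
injective⇒surjective {suc n} f inj y with Fin.any? (λ x → f x Fin.≟ y)
... | yes hit = hit
... | no miss = ⊥-elim (1+n≰n (Fin.injective⇒≤ punchedInjective))
  where
  hit-free : ∀ x → y ≢ f x
  hit-free x y≡fx = miss (x , sym y≡fx)
  punched : Fin (suc n) → Fin n
  punched x = Fin.punchOut (hit-free x)
  punchedInjective : Injective _≡_ _≡_ punched
  punchedInjective {x} {x′} = inj ∘ Fin.punchOut-injective (hit-free x) (hit-free x′)

argmax-or-empty : ∀ {N} (P : Fin N → Bool) (f : Fin N → ℕ) →
  (∃ λ M → T (P M) × (∀ d → T (P d) → f d ≤ f M)) ⊎ (∀ d → ¬ T (P d))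
argmax-or-empty {zero} P f = inj₂ λ ()
argmax-or-empty {suc N} P f with argmax-or-empty (P ∘ Fin.suc) (f ∘ Fin.suc) | T? (P Fin.zero)
... | inj₂ none | no ¬P0 = inj₂ λ { Fin.zero → ¬P0 ; (Fin.suc d) → none d }
... | inj₂ none | yes P0 = inj₁ (Fin.zero , P0 , λ { Fin.zero _ → ≤-refl ; (Fin.suc d) Pd → ⊥-elim (none d Pd) })
... | inj₁ (M , PM , max) | no ¬P0 =
  inj₁ (Fin.suc M , PM , λ { Fin.zero P0 → ⊥-elim (¬P0 P0) ; (Fin.suc d) Pd → max d Pd })
... | inj₁ (M , PM , max) | yes P0 with f (Fin.suc M) ≤? f Fin.zero
...   | yes fM≤f0 = inj₁ (Fin.zero , P0 , λ { Fin.zero _ → ≤-refl ; (Fin.suc d) Pd → ≤-trans (max d Pd) fM≤f0 })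
...   | no fM≰f0 = inj₁ (Fin.suc M , PM , λ { Fin.zero _ → ≰⇒≥ fM≰f0 ; (Fin.suc d) Pd → max d Pd })

argmax : ∀ {N} (P : Fin N → Bool) (f : Fin N → ℕ) d → T (P d) →
  ∃ λ M → T (P M) × (∀ d → T (P d) → f d ≤ f M)
argmax P f d Pd with argmax-or-empty P f
... | inj₁ max = max
... | inj₂ none = ⊥-elim (none d Pd)

-- Certified non-inversions and step weights

record Certified {N} (k : ℕ) (π : Vec (Fin N) N) (a c b : Fin N) : Set where
  field
    a<c    : toℕ a < toℕ c
    c<b    : toℕ c < toℕ b
    b≡a+k  : toℕ b ≡ toℕ a + k
    πa<πb  : val π a < val π b
    πb<πc  : val π b < val π c
    πc-max : ∀ d → toℕ a < toℕ d → toℕ d < toℕ b → val π d ≤ val π c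

module _ {N} (k : ℕ) (π : Vec (Fin N) N) (a c b : Fin N) where

  certifiedᵇ⇒ : T (certifiedᵇ k π a c b) → Certified k π a c b
  certifiedᵇ⇒ t
    with t₁ , t ← ∧-elim t
    with t₂ , t ← ∧-elim t
    with t₃ , t ← ∧-elim t
    with t₄ , t ← ∧-elim t
    with t₅ , t₆ ← ∧-elim t
    = record
      { a<c    = <ᵇ⇒< (toℕ a) (toℕ c) t₁
      ; c<b    = <ᵇ⇒< (toℕ c) (toℕ b) t₂
      ; b≡a+k  = ≡ᵇ⇒≡ (toℕ b) (toℕ a + k) t₃
      ; πa<πb  = <ᵇ⇒< (val π a) (val π b) t₄
      ; πb<πc  = <ᵇ⇒< (val π b) (val π c) t₅
      ; πc-max = λ d a<d d<b → ≮⇒≥ λ πc<πd →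
          T-not⇒¬T (allᵇ-tabulate⇒ _ id t₆ d) (∧-intro (<⇒<ᵇ a<d) (∧-intro (<⇒<ᵇ d<b) (<⇒<ᵇ πc<πd)))
      }

  certifiedᵇ⇐ : Certified k π a c b → T (certifiedᵇ k π a c b)
  certifiedᵇ⇐ cert =
    ∧-intro (<⇒<ᵇ a<c) (∧-intro (<⇒<ᵇ c<b) (∧-intro (≡⇒≡ᵇ (toℕ b) (toℕ a + k) b≡a+k)
      (∧-intro (<⇒<ᵇ πa<πb) (∧-intro (<⇒<ᵇ πb<πc) (allᵇ-tabulate⇐ _ id noneAbove)))))
    where
    open Certified cert
    noneAbove : ∀ d → T (not ((toℕ a <ᵇ toℕ d) ∧ (toℕ d <ᵇ toℕ b) ∧ (val π c <ᵇ val π d)))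
    noneAbove d = ¬T⇒T-not λ t →
      let (a<ᵇd , t′) = ∧-elim t ; (d<ᵇb , c<ᵇd) = ∧-elim t′ in
      <⇒≱ (<ᵇ⇒< (val π c) (val π d) c<ᵇd) (πc-max d (<ᵇ⇒< (toℕ a) (toℕ d) a<ᵇd) (<ᵇ⇒< (toℕ d) (toℕ b) d<ᵇb))

certified-unique : ∀ {N} k (π : Vec (Fin N) N) → Injective _≡_ _≡_ (lookup π) → ∀ {a b c c′} →
  Certified k π a c b → Certified k π a c′ b → c ≡ c′
certified-unique k π inj {c = c} {c′} cert cert′ =
  inj (Fin.toℕ-injective (≤-antisym (C′.πc-max c C.a<c C.c<b) (C.πc-max c′ C′.a<c C′.c<b)))
  where
  module C = Certified cert
  module C′ = Certified cert′

stepWeight : ∀ {N} → ℕ → Vec (Fin N) N → Fin N → Fin N → ℕ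
stepWeight {N} k π a b = 𝟙 (val π b <ᵇ val π a) + ∑[ c < N ] 𝟙 (certifiedᵇ k π a c b)

stepWeight-endMax : ∀ {N} k (π : Vec (Fin N) N) a b → toℕ a < toℕ b →
  (∀ d → toℕ a ≤ toℕ d → toℕ d < toℕ b → val π d < val π b) → stepWeight k π a b ≡ 0
stepWeight-endMax k π a b a<b top = cong₂ _+_ noInversion (sum-zero _ noCertificate)
  where
  noInversion : 𝟙 (val π b <ᵇ val π a) ≡ 0
  noInversion = 𝟙-¬T λ t → <-asym (<ᵇ⇒< _ _ t) (top a ≤-refl a<b)
  noCertificate : ∀ c → 𝟙 (certifiedᵇ k π a c b) ≡ 0
  noCertificate c = 𝟙-¬T λ t → let open Certified (certifiedᵇ⇒ k π a c b t) in <-asym πb<πc (top c (<⇒≤ a<c) c<b)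

stepWeight-endNotMax : ∀ {N} k (π : Vec (Fin N) N) → Injective _≡_ _≡_ (lookup π) → ∀ a b d →
  toℕ b ≡ toℕ a + k → toℕ a ≤ toℕ d → toℕ d < toℕ b → val π b < val π d → stepWeight k π a b ≡ 1
stepWeight-endNotMax {N} k π inj a b d b≡a+k a≤d d<b πb<πd with T? (val π b <ᵇ val π a)
... | yes inversion = cong₂ _+_ (𝟙-T inversion) (sum-zero _ noCertificate)
  where
  noCertificate : ∀ c → 𝟙 (certifiedᵇ k π a c b) ≡ 0
  noCertificate c = 𝟙-¬T λ t → <-asym (Certified.πa<πb (certifiedᵇ⇒ k π a c b t)) (<ᵇ⇒< _ _ inversion)
... | no ¬inversion = cong₂ _+_ (𝟙-¬T ¬inversion) (trans (sum-single _ M onlyM) (𝟙-T (certifiedᵇ⇐ k π a M b certM)))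
  where
  πb≮πa : ¬ val π b < val π a
  πb≮πa = ¬inversion ∘ <⇒<ᵇ
  a<d : toℕ a < toℕ d
  a<d = ≤∧≢⇒< a≤d λ a≡d → πb≮πa (subst (λ x → val π b < val π x) (sym (Fin.toℕ-injective a≡d)) πb<πd)
  inside : Fin N → Bool
  inside c = (toℕ a <ᵇ toℕ c) ∧ (toℕ c <ᵇ toℕ b)
  inside⇒ : ∀ {c} → T (inside c) → toℕ a < toℕ c × toℕ c < toℕ b
  inside⇒ {c} t = <ᵇ⇒< (toℕ a) (toℕ c) (proj₁ (∧-elim t)) , <ᵇ⇒< (toℕ c) (toℕ b) (proj₂ (∧-elim t))
  inside⇐ : ∀ {c} → toℕ a < toℕ c → toℕ c < toℕ b → T (inside c)
  inside⇐ a<c c<b = ∧-intro (<⇒<ᵇ a<c) (<⇒<ᵇ c<b)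
  maximum : ∃ λ M → T (inside M) × (∀ c → T (inside c) → val π c ≤ val π M)
  maximum = argmax inside (val π) d (inside⇐ a<d d<b)
  M : Fin N
  M = proj₁ maximum
  M-inside : toℕ a < toℕ M × toℕ M < toℕ b
  M-inside = inside⇒ (proj₁ (proj₂ maximum))
  M-max : ∀ c → toℕ a < toℕ c → toℕ c < toℕ b → val π c ≤ val π M
  M-max c a<c c<b = proj₂ (proj₂ maximum) c (inside⇐ a<c c<b)
  πa<πb : val π a < val π b
  πa<πb = ≤∧≢⇒< (≮⇒≥ πb≮πa) λ πa≡πb →
    <-irrefl (cong toℕ (inj (Fin.toℕ-injective πa≡πb))) (<-≤-trans a<d (<⇒≤ d<b))
  certM : Certified k π a M b
  certM = record { a<c = proj₁ M-inside ; c<b = proj₂ M-inside ; b≡a+k = b≡a+k ; πa<πb = πa<πb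
                 ; πb<πc = <-≤-trans πb<πd (M-max d a<d d<b) ; πc-max = M-max }
  onlyM : ∀ c → c ≢ M → 𝟙 (certifiedᵇ k π a c b) ≡ 0
  onlyM c c≢M = 𝟙-¬T λ t → c≢M (certified-unique k π inj (certifiedᵇ⇒ k π a c b t) certM)

rowWeight : ∀ {N} → ℕ → Vec (Fin N) N → Fin N → ℕ
rowWeight {N} k π a =
  ∑[ b < N ] 𝟙 ((toℕ b ≡ᵇ toℕ a + k) ∧ (val π b <ᵇ val π a)) + ∑[ c < N ] ∑[ b < N ] 𝟙 (certifiedᵇ k π a c b)

ipcni≡∑rowWeight : ∀ {N} k (π : Vec (Fin N) N) → ipcni k π ≡ ∑[ a < N ] rowWeight k π a
ipcni≡∑rowWeight {N} k π = trans (cong₂ _+_ inversions certificates) (sym (∑-distrib-+ inv cert))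
  where
  inverted : Fin N → Fin N → Bool
  inverted a b = (toℕ b ≡ᵇ toℕ a + k) ∧ (val π b <ᵇ val π a)
  inv : Fin N → ℕ
  inv a = ∑[ b < N ] 𝟙 (inverted a b)
  cert : Fin N → ℕ
  cert a = ∑[ c < N ] ∑[ b < N ] 𝟙 (certifiedᵇ k π a c b)
  inversions : stepInv k π ≡ sum inv
  inversions = trans (sumL-map-allFin N _) (sum-cong-≗ {N} λ a → count-allFin (inverted a))
  certificates : stepCNI k π ≡ sum cert
  certificates = trans (sumL-map-allFin N _) (sum-cong-≗ {N} λ a →
                   trans (sumL-map-allFin N _) (sum-cong-≗ {N} λ c → count-allFin (certifiedᵇ k π a c)))

rowWeight-at : ∀ {N} k (π : Vec (Fin N) N) a b → toℕ b ≡ toℕ a + k → rowWeight k π a ≡ stepWeight k π a b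
rowWeight-at {N} k π a b b≡a+k = cong₂ _+_ inversion (sum-cong-≗ {N} λ c → sum-single _ b (otherCertificate c))
  where
  b-unique : ∀ b′ → toℕ b′ ≡ toℕ a + k → b′ ≡ b
  b-unique b′ b′≡a+k = Fin.toℕ-injective (trans b′≡a+k (sym b≡a+k))
  inversion : ∑[ b′ < N ] 𝟙 ((toℕ b′ ≡ᵇ toℕ a + k) ∧ (val π b′ <ᵇ val π a)) ≡ 𝟙 (val π b <ᵇ val π a)
  inversion = trans (sum-single _ b λ b′ b′≢b → 𝟙-¬T (b′≢b ∘ b-unique b′ ∘ ≡ᵇ⇒≡ _ _ ∘ proj₁ ∘ ∧-elim))
                    (cong (λ x → 𝟙 (x ∧ (val π b <ᵇ val π a))) (Equivalence.to T-≡ (≡⇒≡ᵇ _ _ b≡a+k)))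
  otherCertificate : ∀ c b′ → b′ ≢ b → 𝟙 (certifiedᵇ k π a c b′) ≡ 0
  otherCertificate c b′ b′≢b = 𝟙-¬T (b′≢b ∘ b-unique b′ ∘ Certified.b≡a+k ∘ certifiedᵇ⇒ k π a c b′)

rowWeight-none : ∀ {N} k (π : Vec (Fin N) N) a → (∀ b → toℕ b ≢ toℕ a + k) → rowWeight k π a ≡ 0
rowWeight-none {N} k π a none = cong₂ _+_
  (sum-zero {N} _ λ b → 𝟙-¬T (none b ∘ ≡ᵇ⇒≡ _ _ ∘ proj₁ ∘ ∧-elim))
  (sum-zero {N} _ λ c → sum-zero {N} _ λ b → 𝟙-¬T (none b ∘ Certified.b≡a+k ∘ certifiedᵇ⇒ k π a c b))

-- Maximality on a window missing one position

toℕ-largest : ∀ n → toℕ (largest n) ≡ suc n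
toℕ-largest n = Fin.toℕ-fromℕ (suc n)

toℕ-secondLargest : ∀ n → toℕ (secondLargest n) ≡ n
toℕ-secondLargest n = trans (Fin.toℕ-inject₁ (fromℕ n)) (Fin.toℕ-fromℕ n)

secondLargest≢largest : ∀ n → secondLargest n ≢ largest n
secondLargest≢largest n eq = <-irrefl (trans (sym (toℕ-secondLargest n)) (trans (cong toℕ eq) (toℕ-largest n))) (n<1+n n)

below-largest : ∀ {n} (y : Fin (2 + n)) → y ≢ largest n → toℕ y < suc n
below-largest {n} y y≢top = ≤∧≢⇒< (s≤s⁻¹ (Fin.toℕ<n y)) λ eq → y≢top (Fin.toℕ-injective (trans eq (sym (toℕ-largest n))))

below-secondLargest : ∀ {n} (y : Fin (2 + n)) → y ≢ largest n → y ≢ secondLargest n → toℕ y < n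
below-secondLargest {n} y y≢top y≢next =
  ≤∧≢⇒< (s≤s⁻¹ (below-largest y y≢top)) λ eq → y≢next (Fin.toℕ-injective (trans eq (sym (toℕ-secondLargest n))))

isMaxExceptᵇ : ∀ {n} → Fin (2 + n) → Fin (2 + n) → Bool
isMaxExceptᵇ {n} x y = (x =ᶠ largest n) ∨ ((y =ᶠ largest n) ∧ (x =ᶠ secondLargest n))

isMaxExceptᵇ⇒ : ∀ {n} (x y : Fin (2 + n)) → T (isMaxExceptᵇ x y) → x ≡ largest n ⊎ (y ≡ largest n × x ≡ secondLargest n)
isMaxExceptᵇ⇒ x y t with Equivalence.to T-∨ t
... | inj₁ x-top = inj₁ (T-=ᶠ x-top)
... | inj₂ y-top∧x-next = let (y-top , x-next) = ∧-elim y-top∧x-next in inj₂ (T-=ᶠ y-top , T-=ᶠ x-next)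

isMaxExceptᵇ⇐ : ∀ {n} (x y : Fin (2 + n)) → x ≡ largest n ⊎ (y ≡ largest n × x ≡ secondLargest n) → T (isMaxExceptᵇ x y)
isMaxExceptᵇ⇐ x y (inj₁ x-top) = Equivalence.from T-∨ (inj₁ (≡⇒T-=ᶠ x-top))
isMaxExceptᵇ⇐ x y (inj₂ (y-top , x-next)) = Equivalence.from T-∨ (inj₂ (∧-intro (≡⇒T-=ᶠ y-top) (≡⇒T-=ᶠ x-next)))

module _ {n} (π : Vec (Fin (2 + n)) (2 + n)) (inj : Injective _≡_ _≡_ (lookup π)) (b e : Fin (2 + n)) where

  isMaxExcept-sound : T (isMaxExceptᵇ (lookup π b) (lookup π e)) → ∀ d → d ≢ b → d ≢ e → val π d < val π b
  isMaxExcept-sound t d d≢b d≢e with isMaxExceptᵇ⇒ (lookup π b) (lookup π e) t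
  ... | inj₁ πb-top =
    subst (val π d <_) (sym (trans (cong toℕ πb-top) (toℕ-largest n)))
          (below-largest (lookup π d) λ πd-top → d≢b (inj (trans πd-top (sym πb-top))))
  ... | inj₂ (πe-top , πb-next) =
    subst (val π d <_) (sym (trans (cong toℕ πb-next) (toℕ-secondLargest n)))
          (below-secondLargest (lookup π d) (λ πd-top → d≢e (inj (trans πd-top (sym πe-top))))
                                            (λ πd-next → d≢b (inj (trans πd-next (sym πb-next)))))

  isMaxExcept-complete : ¬ T (isMaxExceptᵇ (lookup π b) (lookup π e)) → ∃ λ d → d ≢ b × d ≢ e × val π b < val π d
  isMaxExcept-complete ¬t with injective⇒surjective (lookup π) inj (largest n)
  ... | i , πi-top with i Fin.≟ e
  ...   | no i≢e = i , i≢b , i≢e , πb<πi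
    where
    πb≢top : lookup π b ≢ largest n
    πb≢top πb-top = ¬t (isMaxExceptᵇ⇐ (lookup π b) (lookup π e) (inj₁ πb-top))
    i≢b : i ≢ b
    i≢b refl = πb≢top πi-top
    πb<πi : val π b < val π i
    πb<πi = subst (val π b <_) (sym (trans (cong toℕ πi-top) (toℕ-largest n))) (below-largest (lookup π b) πb≢top)
  ...   | yes refl with injective⇒surjective (lookup π) inj (secondLargest n)
  ...     | j , πj-next = j , j≢b , j≢i , πb<πj
    where
    πb≢top : lookup π b ≢ largest n
    πb≢top πb-top = ¬t (isMaxExceptᵇ⇐ (lookup π b) (lookup π e) (inj₁ πb-top))
    πb≢next : lookup π b ≢ secondLargest n
    πb≢next πb-next = ¬t (isMaxExceptᵇ⇐ (lookup π b) (lookup π i) (inj₂ (πi-top , πb-next)))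
    j≢b : j ≢ b
    j≢b refl = πb≢next πj-next
    j≢i : j ≢ i
    j≢i refl = secondLargest≢largest n (trans (sym πj-next) πi-top)
    πb<πj : val π b < val π j
    πb<πj = subst (val π b <_) (sym (trans (cong toℕ πj-next) (toℕ-secondLargest n)))
                  (below-secondLargest (lookup π b) πb≢top πb≢next)

stepWeight-window : ∀ {n} k (π : Vec (Fin (2 + n)) (2 + n)) → Injective _≡_ _≡_ (lookup π) → ∀ a b e →
  toℕ a < toℕ b → toℕ b ≡ toℕ a + k →
  (∀ d → toℕ a ≤ toℕ d → toℕ d < toℕ b → d ≢ e) →
  (∀ d → d ≢ b → d ≢ e → toℕ a ≤ toℕ d × toℕ d < toℕ b) →
  stepWeight k π a b ≡ 𝟙 (not (isMaxExceptᵇ (lookup π b) (lookup π e)))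
stepWeight-window k π inj a b e a<b b≡a+k window∌e window∋ with T? (isMaxExceptᵇ (lookup π b) (lookup π e))
... | yes max = trans (stepWeight-endMax k π a b a<b top) (sym (𝟙-¬T λ t → T-not⇒¬T t max))
  where
  top : ∀ d → toℕ a ≤ toℕ d → toℕ d < toℕ b → val π d < val π b
  top d a≤d d<b = isMaxExcept-sound π inj b e max d (λ d≡b → <-irrefl (cong toℕ d≡b) d<b) (window∌e d a≤d d<b)
... | no ¬max with isMaxExcept-complete π inj b e ¬max
...   | d , d≢b , d≢e , πb<πd = let (a≤d , d<b) = window∋ d d≢b d≢e in
  trans (stepWeight-endNotMax k π inj a b d b≡a+k a≤d d<b πb<πd) (sym (𝟙-T (¬T⇒T-not ¬max)))

-- The case k = n - 2

-- Positions are 0, …, N − 1, so the (N − 2)-step pairs are (0, N − 2) and (1, N − 1); each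
-- window misses only position N − 1, resp. 0, so these say that π is maximal at the window's end.
firstWindowPeak : ∀ {n} → Vec (Fin (2 + n)) (2 + n) → Bool
firstWindowPeak {n} π = isMaxExceptᵇ (lookup π (secondLargest n)) (lookup π (largest n))

secondWindowPeak : ∀ {n} → Vec (Fin (2 + n)) (2 + n) → Bool
secondWindowPeak {n} π = isMaxExceptᵇ (lookup π (largest n)) (lookup π Fin.zero)

ipcni≡windowFailures : ∀ m (π : Vec (Fin (3 + m)) (3 + m)) → Injective _≡_ _≡_ (lookup π) →
  ipcni (suc m) π ≡ 𝟙 (not (firstWindowPeak π)) + 𝟙 (not (secondWindowPeak π))
ipcni≡windowFailures m π inj = begin
  ipcni (suc m) π
    ≡⟨ ipcni≡∑rowWeight (suc m) π ⟩
  row Fin.zero + (row (Fin.suc Fin.zero) + ∑[ a < suc m ] row (Fin.suc (Fin.suc a)))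
    ≡⟨ cong₂ _+_ firstRow (cong₂ _+_ secondRow laterRows) ⟩
  𝟙 (not (firstWindowPeak π)) + (𝟙 (not (secondWindowPeak π)) + 0)
    ≡⟨ cong (𝟙 (not (firstWindowPeak π)) +_) (+-identityʳ _) ⟩
  𝟙 (not (firstWindowPeak π)) + 𝟙 (not (secondWindowPeak π))
    ∎
  where
  open ≡-Reasoning
  row : Fin (3 + m) → ℕ
  row = rowWeight (suc m) π
  last penult : Fin (3 + m)
  last = largest (suc m)
  penult = secondLargest (suc m)
  toℕ-last : toℕ last ≡ 2 + m
  toℕ-last = toℕ-largest (suc m)
  toℕ-penult : toℕ penult ≡ suc m
  toℕ-penult = toℕ-secondLargest (suc m)
  firstRow : row Fin.zero ≡ 𝟙 (not (firstWindowPeak π))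
  firstRow = trans (rowWeight-at (suc m) π Fin.zero penult toℕ-penult)
    (stepWeight-window (suc m) π inj Fin.zero penult last (subst (0 <_) (sym toℕ-penult) z<s) toℕ-penult
      (λ { d _ d<penult refl → <-asym d<penult (subst₂ _<_ (sym toℕ-penult) (sym toℕ-last) (n<1+n (suc m))) })
      (λ d d≢penult d≢last → z≤n , subst (toℕ d <_) (sym toℕ-penult) (below-secondLargest d d≢last d≢penult)))
  secondRow : row (Fin.suc Fin.zero) ≡ 𝟙 (not (secondWindowPeak π))
  secondRow = trans (rowWeight-at (suc m) π (Fin.suc Fin.zero) last toℕ-last)
    (stepWeight-window (suc m) π inj (Fin.suc Fin.zero) last Fin.zero (subst (1 <_) (sym toℕ-last) (s<s z<s)) toℕ-last
      (λ { d () _ refl })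
      (λ d d≢last d≢0 → 1≤toℕ d d≢0 , subst (toℕ d <_) (sym toℕ-last) (below-largest d d≢last)))
    where
    1≤toℕ : ∀ (d : Fin (3 + m)) → d ≢ Fin.zero → 1 ≤ toℕ d
    1≤toℕ Fin.zero d≢0 = ⊥-elim (d≢0 refl)
    1≤toℕ (Fin.suc d) _ = s≤s z≤n
  laterRows : ∑[ a < suc m ] row (Fin.suc (Fin.suc a)) ≡ 0
  laterRows = sum-zero {suc m} _ λ a → rowWeight-none (suc m) π (Fin.suc (Fin.suc a)) (tooLate a)
    where
    tooLate : ∀ (a : Fin (suc m)) (b : Fin (3 + m)) → toℕ b ≢ toℕ (Fin.suc (Fin.suc a)) + suc m
    tooLate a b b≡ = <⇒≱ (Fin.toℕ<n b) (subst (3 + m ≤_) (sym b≡) (s≤s (s≤s (m≤n+m (suc m) (toℕ a)))))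

distinctPairs-isMaxExcept : ∀ n → distinctPairs {2 + n} (λ x y → isMaxExceptᵇ y x) ≡ 2 + n
distinctPairs-isMaxExcept n =
  trans (sum-cong-≗ {2 + n} exactlyOnePartner) (trans (sum-const (2 + n) 1) (*-identityʳ (2 + n)))
  where
  top next : Fin (2 + n)
  top = largest n
  next = secondLargest n
  partners : Fin (2 + n) → ℕ
  partners x = ∑[ y < 2 + n ] 𝟙 (not (x =ᶠ y) ∧ isMaxExceptᵇ y x)
  partnersOfTop : partners top ≡ 1
  partnersOfTop = trans (sum-single _ next notPartner)
    (𝟙-T (∧-intro (¬T⇒T-not (≢⇒¬T-=ᶠ (secondLargest≢largest n ∘ sym))) (isMaxExceptᵇ⇐ next top (inj₂ (refl , refl)))))
    where
    notPartner : ∀ y → y ≢ next → 𝟙 (not (top =ᶠ y) ∧ isMaxExceptᵇ y top) ≡ 0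
    notPartner y y≢next = 𝟙-¬T λ t → let (top≢y , max) = ∧-elim t in
      [ (λ y≡top → T-not⇒¬T top≢y (≡⇒T-=ᶠ (sym y≡top))) , (λ (_ , y≡next) → y≢next y≡next) ] (isMaxExceptᵇ⇒ y top max)
  partnersOfOther : ∀ x → x ≢ top → partners x ≡ 1
  partnersOfOther x x≢top = trans (sum-single _ top notPartner)
    (𝟙-T (∧-intro (¬T⇒T-not (≢⇒¬T-=ᶠ x≢top)) (isMaxExceptᵇ⇐ top x (inj₁ refl))))
    where
    notPartner : ∀ y → y ≢ top → 𝟙 (not (x =ᶠ y) ∧ isMaxExceptᵇ y x) ≡ 0
    notPartner y y≢top = 𝟙-¬T λ t →
      [ y≢top , (λ (x≡top , _) → x≢top x≡top) ] (isMaxExceptᵇ⇒ y x (proj₂ (∧-elim t)))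
  exactlyOnePartner : ∀ x → partners x ≡ 1
  exactlyOnePartner x = byCases (x Fin.≟ top)
    where
    byCases : Dec (x ≡ top) → partners x ≡ 1
    byCases (yes x≡top) = subst (λ z → partners z ≡ 1) (sym x≡top) partnersOfTop
    byCases (no x≢top) = partnersOfOther x x≢top

bothPeaks : ∀ {n} (x u w : Fin (2 + n)) → u ≢ w → u ≢ x →
  isMaxExceptᵇ u w ∧ isMaxExceptᵇ w x ≡ (w =ᶠ largest n) ∧ (u =ᶠ secondLargest n)
bothPeaks {n} x u w u≢w u≢x = T-ext forward backward
  where
  forward : T (isMaxExceptᵇ u w ∧ isMaxExceptᵇ w x) → T ((w =ᶠ largest n) ∧ (u =ᶠ secondLargest n))
  forward t with ∧-elim t
  ... | uMax , wMax with isMaxExceptᵇ⇒ u w uMax | isMaxExceptᵇ⇒ w x wMax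
  ...   | inj₂ (w-top , u-next) | _ = ∧-intro (≡⇒T-=ᶠ w-top) (≡⇒T-=ᶠ u-next)
  ...   | inj₁ u-top | inj₁ w-top = ⊥-elim (u≢w (trans u-top (sym w-top)))
  ...   | inj₁ u-top | inj₂ (x-top , _) = ⊥-elim (u≢x (trans u-top (sym x-top)))
  backward : T ((w =ᶠ largest n) ∧ (u =ᶠ secondLargest n)) → T (isMaxExceptᵇ u w ∧ isMaxExceptᵇ w x)
  backward t = let (w-top , u-next) = ∧-elim t in
    ∧-intro (isMaxExceptᵇ⇐ u w (inj₂ (T-=ᶠ w-top , T-=ᶠ u-next))) (isMaxExceptᵇ⇐ w x (inj₁ (T-=ᶠ w-top)))

distinctPairs-topNext : ∀ n → distinctPairs {2 + n} (λ w u → (w =ᶠ largest n) ∧ (u =ᶠ secondLargest n)) ≡ 1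
distinctPairs-topNext n =
  trans (sum-single (λ w → ∑[ u < 2 + n ] 𝟙 (not (w =ᶠ u) ∧ ((w =ᶠ top) ∧ (u =ᶠ next)))) top notTop)
        (trans (sum-single (λ u → 𝟙 (not (top =ᶠ u) ∧ ((top =ᶠ top) ∧ (u =ᶠ next)))) next notNext) (𝟙-T pair))
  where
  top next : Fin (2 + n)
  top = largest n
  next = secondLargest n
  notTop : ∀ w → w ≢ top → ∑[ u < 2 + n ] 𝟙 (not (w =ᶠ u) ∧ ((w =ᶠ top) ∧ (u =ᶠ next))) ≡ 0
  notTop w w≢top = sum-zero (λ u → 𝟙 (not (w =ᶠ u) ∧ ((w =ᶠ top) ∧ (u =ᶠ next)))) λ u → 𝟙-¬T λ t →
    ≢⇒¬T-=ᶠ w≢top (proj₁ (∧-elim {w =ᶠ top} (proj₂ (∧-elim {not (w =ᶠ u)} t))))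
  notNext : ∀ u → u ≢ next → 𝟙 (not (top =ᶠ u) ∧ ((top =ᶠ top) ∧ (u =ᶠ next))) ≡ 0
  notNext u u≢next = 𝟙-¬T λ t → ≢⇒¬T-=ᶠ u≢next (proj₂ (∧-elim {top =ᶠ top} (proj₂ (∧-elim {not (top =ᶠ u)} t))))
  pair : T (not (top =ᶠ next) ∧ ((top =ᶠ top) ∧ (next =ᶠ next)))
  pair = ∧-intro (¬T⇒T-not (≢⇒¬T-=ᶠ (secondLargest≢largest n ∘ sym)))
                 (∧-intro {top =ᶠ top} (≡⇒T-=ᶠ {x = top} refl) (≡⇒T-=ᶠ {x = next} refl))

countPerms-bothPeaks : ∀ m → countPerms (3 + m) (λ π → firstWindowPeak π ∧ secondWindowPeak π) ≡ suc m !
countPerms-bothPeaks m = begin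
  countPerms (3 + m) (λ π → firstWindowPeak π ∧ secondWindowPeak π)
    ≡⟨ countPerms-cong (3 + m) (λ π d → bothPeaks (lookup π Fin.zero) (lookup π penult) (lookup π last)
                                          (≢-on π d (secondLargest≢largest (suc m))) (≢-on π d (Fin.0≢1+n ∘ sym))) ⟩
  countPerms (3 + m) (λ π → (lookup π last =ᶠ largest (suc m)) ∧ (lookup π penult =ᶠ secondLargest (suc m)))
    ≡⟨ countPerms-lastTwo (suc m) (λ w u → (w =ᶠ largest (suc m)) ∧ (u =ᶠ secondLargest (suc m))) ⟩
  distinctPairs (λ w u → (w =ᶠ largest (suc m)) ∧ (u =ᶠ secondLargest (suc m))) * suc m !
    ≡⟨ cong (_* suc m !) (distinctPairs-topNext (suc m)) ⟩
  1 * suc m !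
    ≡⟨ *-identityˡ (suc m !) ⟩
  suc m ! ∎
  where
  open ≡-Reasoning
  last penult : Fin (3 + m)
  last = largest (suc m)
  penult = secondLargest (suc m)
  ≢-on : ∀ (π : Vec (Fin (3 + m)) (3 + m)) → T (distinctᵇ π) → ∀ {i j} → i ≢ j → lookup π i ≢ lookup π j
  ≢-on π d i≢j = i≢j ∘ distinctᵇ⇒ π d

countPerms-firstWindowPeak : ∀ n → countPerms (2 + n) firstWindowPeak ≡ (2 + n) * n !
countPerms-firstWindowPeak n =
  trans (countPerms-lastTwo n (λ w u → isMaxExceptᵇ u w)) (cong (_* n !) (distinctPairs-isMaxExcept n))

countPerms-secondWindowPeak : ∀ n → countPerms (2 + n) secondWindowPeak ≡ (2 + n) * n !
countPerms-secondWindowPeak n =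
  trans (countPerms-firstLast n (λ x w → isMaxExceptᵇ w x)) (cong (_* n !) (distinctPairs-isMaxExcept n))

Kcoeff≡exactly : ∀ m j → Kcoeff (3 + m) (suc m) j ≡ exactly firstWindowPeak secondWindowPeak (S (3 + m)) j
Kcoeff≡exactly m j = begin
  count (λ π → ipcni (suc m) π ≡ᵇ j) (S (3 + m))                ≡⟨ count-S (3 + m) _ ⟩
  countPerms (3 + m) (λ π → ipcni (suc m) π ≡ᵇ j)                ≡⟨ countPerms-cong (3 + m) atMostTwoFailures ⟩
  countPerms (3 + m) (λ π → failures A B π ≡ᵇ j)                 ≡⟨ count-S (3 + m) _ ⟨
  count (λ π → failures A B π ≡ᵇ j) (S (3 + m))                  ∎
  where
  open ≡-Reasoning
  A B : Vec (Fin (3 + m)) (3 + m) → Bool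
  A = firstWindowPeak
  B = secondWindowPeak
  atMostTwoFailures : ∀ π → T (distinctᵇ π) → (ipcni (suc m) π ≡ᵇ j) ≡ (failures A B π ≡ᵇ j)
  atMostTwoFailures π d = cong (_≡ᵇ j) (ipcni≡windowFailures m π (distinctᵇ⇒ π d))

module _ (m : ℕ) where

  private
    N K : ℕ
    N = 3 + m
    K = suc m !
    A B : Vec (Fin N) N → Bool
    A = firstWindowPeak
    B = secondWindowPeak
    #A : count A (S N) ≡ N * K
    #A = trans (count-S N A) (countPerms-firstWindowPeak (suc m))
    #B : count B (S N) ≡ N * K
    #B = trans (count-S N B) (countPerms-secondWindowPeak (suc m))
    #A∩B : count (λ π → A π ∧ B π) (S N) ≡ K
    #A∩B = trans (count-S N _) (countPerms-bothPeaks m)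

  exactly-0-value : exactly A B (S N) 0 ≡ K * 1
  exactly-0-value = trans (exactly-0 A B (S N)) (trans #A∩B (sym (*-identityʳ K)))

  exactly-1-value : exactly A B (S N) 1 ≡ K * (2 * (2 + m))
  exactly-1-value = +-cancelʳ-≡ (K + K) _ _ (begin
    exactly A B (S N) 1 + (K + K)
      ≡⟨ cong (λ c → exactly A B (S N) 1 + (c + c)) #A∩B ⟨
    exactly A B (S N) 1 + (both A B (S N) + both A B (S N))
      ≡⟨ exactly-1 A B (S N) ⟩
    count A (S N) + count B (S N)
      ≡⟨ cong₂ _+_ #A #B ⟩
    N * K + N * K
      ≡⟨ solve 2 (λ m K → (con 3 :+ m) :* K :+ (con 3 :+ m) :* K := K :* (con 2 :* (con 2 :+ m)) :+ (K :+ K)) refl m K ⟩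
    K * (2 * (2 + m)) + (K + K)
      ∎)
    where open ≡-Reasoning

  exactly-2-value : exactly A B (S N) 2 ≡ K * (N * N + 1 ∸ 3 * N)
  exactly-2-value = trans (+-cancelʳ-≡ (N * K + N * K) _ _ (begin
    exactly A B (S N) 2 + (N * K + N * K)
      ≡⟨ cong (exactly A B (S N) 2 +_) (cong₂ _+_ #A #B) ⟨
    exactly A B (S N) 2 + (count A (S N) + count B (S N))
      ≡⟨ exactly-2 A B (S N) ⟩
    count (λ _ → true) (S N) + both A B (S N)
      ≡⟨ cong₂ _+_ (count-S-all N) #A∩B ⟩
    N * ((2 + m) * K) + K
      ≡⟨ solve 2 (λ m K → (con 3 :+ m) :* ((con 2 :+ m) :* K) :+ K
                        := K :* (m :* m :+ con 3 :* m :+ con 1) :+ ((con 3 :+ m) :* K :+ (con 3 :+ m) :* K)) refl m K ⟩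
    K * (m * m + 3 * m + 1) + (N * K + N * K)
      ∎)) (cong (K *_) (sym quadratic))
    where
    open ≡-Reasoning
    quadratic : N * N + 1 ∸ 3 * N ≡ m * m + 3 * m + 1
    quadratic = trans (cong (_∸ 3 * N) (solve 1 (λ m → (con 3 :+ m) :* (con 3 :+ m) :+ con 1
                                                     := (m :* m :+ con 3 :* m :+ con 1) :+ con 3 :* (con 3 :+ m)) refl m))
                      (m+n∸n≡m (m * m + 3 * m + 1) (3 * N))

  exactly-value : ∀ j → exactly A B (S N) j ≡ K * rhsCoeff N j
  exactly-value 0 = exactly-0-value
  exactly-value 1 = exactly-1-value
  exactly-value 2 = exactly-2-value
  exactly-value (suc (suc (suc j))) = trans (exactly-3+ A B (S N) j) (sym (*-zeroʳ K))

proposition5p6 : (n : ℕ) → 3 ≤ n →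
    (Kcoeff n (n ∸ 2) 2 ≡ (n ∸ 2) ! * (n * n + 1 ∸ 3 * n))
    × ((j : ℕ) → Kcoeff n (n ∸ 2) j ≡ (n ∸ 2) ! * rhsCoeff n j)
proposition5p6 (suc (suc (suc m))) (s≤s (s≤s (s≤s _))) = coefficient 2 , coefficient
  where
  coefficient : ∀ j → Kcoeff (3 + m) (suc m) j ≡ suc m ! * rhsCoeff (3 + m) j
  coefficient j = trans (Kcoeff≡exactly m j) (exactly-value m j)
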